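{- Let $\tau$ be a vocabulary with $\aleph_0$ constants and let $T$ be a first-order $\tau$-theory such that, for any model of $T$, the substructure consisting of the elements named by these constants is a model of $T$. Then no model of $T^{\omega}$ has a proper extension (that is a model of $T^\omega$).
   Context: $T^\omega$ denotes the set of consequences of $T$ in inferential $\omega$-logic, whose models are the structures carrying an admissible valuation. Inferential $\omega$-logic: classical first-order natural deduction extended by, for any countable set $C$ of constants containing $\mathrm{Const}(\tau)$ and any formula $\phi(x,\bar d)$ with parameters from $C$: $I$-$\omega$-rule: from $\{\phi(c,\bar d):c\in\mathrm{Const}(\tau)\}$ infer $(\forall x)\phi(x,\bar d)$; $I$-$\forall E$: from $(\forall x)\phi(x,\bar d)$ infer $\phi(e,\bar d)$ for each $e\in C$; plus matching existential rules. A valuation (Robinson semantics, with constants from $C$ naming elements) is admissible if it assigns consistent truth values to all quantifier-free sentences respecting the identity rules, and every rule instance with true premises has a true conclusion. -}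

module Defs where

open import Data.Nat using (ℕ; zero; suc)
open import Data.Fin using (Fin; zero; suc)
open import Data.Bool using (Bool; true; false; not; _∧_; _∨_)
open import Data.Empty using (⊥; ⊥-elim)
open import Data.Unit using (⊤)
open import Data.Sum using (_⊎_)
open import Data.Product using (Σ; _×_; _,_)
open import Relation.Nullary using (¬_)
open import Relation.Binary.PropositionalEquality using (_≡_; _≢_)

-- Vocabularies with ℵ₀ constants (the constants are indexed by ℕ).

record Vocabulary : Set₁ where
  field
    FunSym   : Set
    funArity : FunSym → ℕ
    RelSym   : Set
    relArity : RelSym → ℕ

open Vocabulary public

-- Syntax. Terms/formulas over τ with extra parameter constants from P
-- and de Bruijn variables Fin n. Constants of τ are  con c  (c : ℕ).

data Term (τ : Vocabulary) (P : Set) (n : ℕ) : Set where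
  var : Fin n → Term τ P n
  con : ℕ → Term τ P n
  par : P → Term τ P n
  app : (f : FunSym τ) → (Fin (funArity τ f) → Term τ P n) → Term τ P n

data Formula (τ : Vocabulary) (P : Set) : ℕ → Set where
  rel  : ∀ {n} (R : RelSym τ) → (Fin (relArity τ R) → Term τ P n) → Formula τ P n
  _≐_  : ∀ {n} → Term τ P n → Term τ P n → Formula τ P n
  ⊥'   : ∀ {n} → Formula τ P n
  ¬'_  : ∀ {n} → Formula τ P n → Formula τ P n
  _∧'_ : ∀ {n} → Formula τ P n → Formula τ P n → Formula τ P n
  _∨'_ : ∀ {n} → Formula τ P n → Formula τ P n → Formula τ P n
  _⇒'_ : ∀ {n} → Formula τ P n → Formula τ P n → Formula τ P n
  ∀'   : ∀ {n} → Formula τ P (suc n) → Formula τ P n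
  ∃'   : ∀ {n} → Formula τ P (suc n) → Formula τ P n

-- sentences with parameters from P; τ-sentences are  Sentence τ ⊥
Sentence : Vocabulary → Set → Set
Sentence τ P = Formula τ P 0

module _ {τ : Vocabulary} where

  mapT : ∀ {P Q n} → (P → Q) → Term τ P n → Term τ Q n
  mapT h (var i) = var i
  mapT h (con c) = con c
  mapT h (par p) = par (h p)
  mapT h (app f ts) = app f (λ i → mapT h (ts i))

  mapF : ∀ {P Q n} → (P → Q) → Formula τ P n → Formula τ Q n
  mapF h (rel R ts) = rel R (λ i → mapT h (ts i))
  mapF h (s ≐ t) = mapT h s ≐ mapT h t
  mapF h ⊥' = ⊥'
  mapF h (¬' φ) = ¬' mapF h φ
  mapF h (φ ∧' ψ) = mapF h φ ∧' mapF h ψ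
  mapF h (φ ∨' ψ) = mapF h φ ∨' mapF h ψ
  mapF h (φ ⇒' ψ) = mapF h φ ⇒' mapF h ψ
  mapF h (∀' φ) = ∀' (mapF h φ)
  mapF h (∃' φ) = ∃' (mapF h φ)

  embed : ∀ {P n} → Formula τ ⊥ n → Formula τ P n
  embed = mapF ⊥-elim

  renT : ∀ {P n m} → (Fin n → Fin m) → Term τ P n → Term τ P m
  renT ρ (var i) = var (ρ i)
  renT ρ (con c) = con c
  renT ρ (par p) = par p
  renT ρ (app f ts) = app f (λ i → renT ρ (ts i))

  liftS : ∀ {P n m} → (Fin n → Term τ P m) → Fin (suc n) → Term τ P (suc m)
  liftS σ zero = var zero
  liftS σ (suc i) = renT suc (σ i)

  subT : ∀ {P n m} → (Fin n → Term τ P m) → Term τ P n → Term τ P m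
  subT σ (var i) = σ i
  subT σ (con c) = con c
  subT σ (par p) = par p
  subT σ (app f ts) = app f (λ i → subT σ (ts i))

  subF : ∀ {P n m} → (Fin n → Term τ P m) → Formula τ P n → Formula τ P m
  subF σ (rel R ts) = rel R (λ i → subT σ (ts i))
  subF σ (s ≐ t) = subT σ s ≐ subT σ t
  subF σ ⊥' = ⊥'
  subF σ (¬' φ) = ¬' subF σ φ
  subF σ (φ ∧' ψ) = subF σ φ ∧' subF σ ψ
  subF σ (φ ∨' ψ) = subF σ φ ∨' subF σ ψ
  subF σ (φ ⇒' ψ) = subF σ φ ⇒' subF σ ψ
  subF σ (∀' φ) = ∀' (subF (liftS σ) φ)
  subF σ (∃' φ) = ∃' (subF (liftS σ) φ)

  _[_] : ∀ {P} → Formula τ P 1 → Term τ P 0 → Sentence τ P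
  φ [ t ] = subF (λ _ → t) φ

  FreshT : ∀ {n} → ℕ → Term τ ℕ n → Set
  FreshT e (var i) = ⊤
  FreshT e (con c) = ⊤
  FreshT e (par d) = d ≢ e
  FreshT e (app f ts) = ∀ i → FreshT e (ts i)

  FreshF : ∀ {n} → ℕ → Formula τ ℕ n → Set
  FreshF e (rel R ts) = ∀ i → FreshT e (ts i)
  FreshF e (s ≐ t) = FreshT e s × FreshT e t
  FreshF e ⊥' = ⊤
  FreshF e (¬' φ) = FreshF e φ
  FreshF e (φ ∧' ψ) = FreshF e φ × FreshF e ψ
  FreshF e (φ ∨' ψ) = FreshF e φ × FreshF e ψ
  FreshF e (φ ⇒' ψ) = FreshF e φ × FreshF e ψ
  FreshF e (∀' φ) = FreshF e φ
  FreshF e (∃' φ) = FreshF e φ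

-- Inferential ω-logic: classical natural deduction (sequent-style, with
-- hypotheses Γ) over sentences with parameters from a countable supply
-- of new constants (ℕ), extended by the I-ω-rule, I-∀E and the matching
-- existential rules.

Ctx : Vocabulary → Set₁
Ctx τ = Sentence τ ℕ → Set

_,,_ : ∀ {τ} → Ctx τ → Sentence τ ℕ → Ctx τ
(Γ ,, φ) ψ = Γ ψ ⊎ ψ ≡ φ

data _⊢_ {τ : Vocabulary} : Ctx τ → Sentence τ ℕ → Set₁ where
  hyp  : ∀ {Γ φ} → Γ φ → Γ ⊢ φ
  ⊥E   : ∀ {Γ φ} → Γ ⊢ ⊥' → Γ ⊢ φ
  raa  : ∀ {Γ φ} → (Γ ,, (¬' φ)) ⊢ ⊥' → Γ ⊢ φ
  ¬I   : ∀ {Γ φ} → (Γ ,, φ) ⊢ ⊥' → Γ ⊢ (¬' φ)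
  ¬E   : ∀ {Γ φ} → Γ ⊢ φ → Γ ⊢ (¬' φ) → Γ ⊢ ⊥'
  ∧I   : ∀ {Γ φ ψ} → Γ ⊢ φ → Γ ⊢ ψ → Γ ⊢ (φ ∧' ψ)
  ∧E₁  : ∀ {Γ φ ψ} → Γ ⊢ (φ ∧' ψ) → Γ ⊢ φ
  ∧E₂  : ∀ {Γ φ ψ} → Γ ⊢ (φ ∧' ψ) → Γ ⊢ ψ
  ∨I₁  : ∀ {Γ φ ψ} → Γ ⊢ φ → Γ ⊢ (φ ∨' ψ)
  ∨I₂  : ∀ {Γ φ ψ} → Γ ⊢ ψ → Γ ⊢ (φ ∨' ψ)
  ∨E   : ∀ {Γ φ ψ χ} → Γ ⊢ (φ ∨' ψ) → (Γ ,, φ) ⊢ χ → (Γ ,, ψ) ⊢ χ → Γ ⊢ χ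
  ⇒I   : ∀ {Γ φ ψ} → (Γ ,, φ) ⊢ ψ → Γ ⊢ (φ ⇒' ψ)
  ⇒E   : ∀ {Γ φ ψ} → Γ ⊢ (φ ⇒' ψ) → Γ ⊢ φ → Γ ⊢ ψ
  ∀I   : ∀ {Γ} {φ : Formula τ ℕ 1} (e : ℕ) →
         (∀ ψ → Γ ψ → FreshF e ψ) → FreshF e φ → Γ ⊢ (φ [ par e ]) → Γ ⊢ ∀' φ
  ∀E   : ∀ {Γ} {φ : Formula τ ℕ 1} (t : Term τ ℕ 0) → Γ ⊢ ∀' φ → Γ ⊢ (φ [ t ])
  ∃I   : ∀ {Γ} {φ : Formula τ ℕ 1} (t : Term τ ℕ 0) → Γ ⊢ (φ [ t ]) → Γ ⊢ ∃' φ
  ∃E   : ∀ {Γ} {φ : Formula τ ℕ 1} {χ} (e : ℕ) →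
         (∀ ψ → Γ ψ → FreshF e ψ) → FreshF e φ → FreshF e χ →
         Γ ⊢ ∃' φ → (Γ ,, (φ [ par e ])) ⊢ χ → Γ ⊢ χ
  ≐refl  : ∀ {Γ} (t : Term τ ℕ 0) → Γ ⊢ (t ≐ t)
  ≐subst : ∀ {Γ} {φ : Formula τ ℕ 1} {s t : Term τ ℕ 0} →
           Γ ⊢ (s ≐ t) → Γ ⊢ (φ [ s ]) → Γ ⊢ (φ [ t ])
  ωI   : ∀ {Γ} {φ : Formula τ ℕ 1} → (∀ c → Γ ⊢ (φ [ con c ])) → Γ ⊢ ∀' φ
  ωE∃  : ∀ {Γ} {φ : Formula τ ℕ 1} {χ} →
         Γ ⊢ ∃' φ → (∀ c → (Γ ,, (φ [ con c ])) ⊢ χ) → Γ ⊢ χ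
  I∀E  : ∀ {Γ} {φ : Formula τ ℕ 1} (e : ℕ) → Γ ⊢ ∀' φ → Γ ⊢ (φ [ par e ])
  I∃I  : ∀ {Γ} {φ : Formula τ ℕ 1} (e : ℕ) → Γ ⊢ (φ [ par e ]) → Γ ⊢ ∃' φ

Theory : Vocabulary → Set₁
Theory τ = Sentence τ ⊥ → Set

_^ω : ∀ {τ} → Theory τ → Sentence τ ⊥ → Set₁
(T ^ω) φ = (λ ψ → Σ _ λ θ → T θ × ψ ≡ embed θ) ⊢ embed φ

record Structure (τ : Vocabulary) : Set₁ where
  field
    Carrier : Set
    const   : ℕ → Carrier
    fun     : (f : FunSym τ) → (Fin (funArity τ f) → Carrier) → Carrier
    relI    : (R : RelSym τ) → (Fin (relArity τ R) → Carrier) → Set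

open Structure public

module _ {τ : Vocabulary} (M : Structure τ) where

  evalT : ∀ {P n} → (P → Carrier M) → (Fin n → Carrier M) → Term τ P n → Carrier M
  evalT π ρ (var i) = ρ i
  evalT π ρ (con c) = const M c
  evalT π ρ (par p) = π p
  evalT π ρ (app f ts) = fun M f (λ i → evalT π ρ (ts i))

  _∷ρ_ : ∀ {n} → Carrier M → (Fin n → Carrier M) → Fin (suc n) → Carrier M
  (a ∷ρ ρ) zero = a
  (a ∷ρ ρ) (suc i) = ρ i

  -- Tarski satisfaction with quantifiers relativised to D
  -- (D = everything: satisfaction in M; D closed under the operations:
  -- satisfaction in the substructure with universe D).
  -- Classical connectives are rendered via the double-negation translation.
  SatIn : (D : Carrier M → Set) → ∀ {P n} → (P → Carrier M) → (Fin n → Carrier M) →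
          Formula τ P n → Set
  SatIn D π ρ (rel R ts) = ¬ ¬ relI M R (λ i → evalT π ρ (ts i))
  SatIn D π ρ (s ≐ t) = ¬ ¬ (evalT π ρ s ≡ evalT π ρ t)
  SatIn D π ρ ⊥' = ⊥
  SatIn D π ρ (¬' φ) = ¬ SatIn D π ρ φ
  SatIn D π ρ (φ ∧' ψ) = SatIn D π ρ φ × SatIn D π ρ ψ
  SatIn D π ρ (φ ∨' ψ) = ¬ (¬ SatIn D π ρ φ × ¬ SatIn D π ρ ψ)
  SatIn D π ρ (φ ⇒' ψ) = SatIn D π ρ φ → SatIn D π ρ ψ
  SatIn D π ρ (∀' φ) = ∀ a → D a → SatIn D π (a ∷ρ ρ) φ
  SatIn D π ρ (∃' φ) = ¬ (∀ a → D a → ¬ SatIn D π (a ∷ρ ρ) φ)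

  noEnv : Fin 0 → Carrier M
  noEnv ()

  ⊨ : Sentence τ ⊥ → Set
  ⊨ φ = SatIn (λ _ → ⊤) ⊥-elim noEnv φ

  Named : Carrier M → Set
  Named a = Σ ℕ λ c → const M c ≡ a

  NamedClosed : Set
  NamedClosed = ∀ f (as : Fin (funArity τ f) → Carrier M) →
                (∀ i → Named (as i)) → Named (fun M f as)

  ⊨Named : Sentence τ ⊥ → Set
  ⊨Named φ = SatIn Named ⊥-elim noEnv φ

Model : ∀ {τ} → Theory τ → Structure τ → Set
Model T M = ∀ φ → T φ → ⊨ M φ

NamedSubmodelProperty : ∀ {τ} → Theory τ → Set₁
NamedSubmodelProperty {τ} T =
  (A : Structure τ) → Model T A → NamedClosed A × (∀ φ → T φ → ⊨Named A φ)

-- Robinson semantics: valuations on sentences whose parameters are the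
-- elements of M (every element has a name), and admissibility.

Valuation : ∀ {τ} → Structure τ → Set
Valuation {τ} M = Sentence τ (Carrier M) → Bool

record Admissible {τ} (M : Structure τ) (v : Valuation M) : Set where
  private
    ev : Term τ (Carrier M) 0 → Carrier M
    ev = evalT M (λ a → a) (noEnv M)
  field
    v-rel : ∀ R ts → (v (rel R ts) ≡ true → relI M R (λ i → ev (ts i)))
                   × (relI M R (λ i → ev (ts i)) → v (rel R ts) ≡ true)
    v-eq  : ∀ s t → (v (s ≐ t) ≡ true → ev s ≡ ev t) × (ev s ≡ ev t → v (s ≐ t) ≡ true)
    v-⊥   : v ⊥' ≡ false
    v-¬   : ∀ φ → v (¬' φ) ≡ not (v φ)
    v-∧   : ∀ φ ψ → v (φ ∧' ψ) ≡ (v φ ∧ v ψ)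
    v-∨   : ∀ φ ψ → v (φ ∨' ψ) ≡ (v φ ∨ v ψ)
    v-⇒   : ∀ φ ψ → v (φ ⇒' ψ) ≡ (not (v φ) ∨ v ψ)
    v-ω   : ∀ φ → (∀ c → v (φ [ con c ]) ≡ true) → v (∀' φ) ≡ true
    v-∀E  : ∀ φ → v (∀' φ) ≡ true → ∀ t → v (φ [ t ]) ≡ true
    v-∃I  : ∀ φ t → v (φ [ t ]) ≡ true → v (∃' φ) ≡ true
    v-ω∃  : ∀ φ → v (∃' φ) ≡ true → ¬ (∀ c → v (φ [ con c ]) ≡ false)

ModelΩ : ∀ {τ} → Theory τ → Structure τ → Set₁
ModelΩ T M = Σ (Valuation M) λ v → Admissible M v × (∀ φ → (T ^ω) φ → v (embed φ) ≡ true)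

record Embedding {τ} (M N : Structure τ) : Set where
  field
    map     : Carrier M → Carrier N
    inj     : ∀ {a b} → map a ≡ map b → a ≡ b
    pres-const : ∀ c → map (const M c) ≡ const N c
    pres-fun   : ∀ f as → map (fun M f as) ≡ fun N f (λ i → map (as i))
    pres-rel   : ∀ R as → (relI M R as → relI N R (λ i → map (as i)))
                        × (relI N R (λ i → map (as i)) → relI M R as)

Proper : ∀ {τ} {M N : Structure τ} → Embedding M N → Set
Proper {N = N} e = Σ (Carrier N) λ b → ∀ a → Embedding.map e a ≢ b

{-# OPTIONS --safe #-}
-- The I-ω-rule forces every element b of a model of T^ω to be named by a
-- constant: otherwise the admissible valuation makes ¬ (c ≐ b) true for every
-- constant c, hence (∀x) ¬ (x ≐ b) true, and instantiating at b refutes b ≐ b.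
-- An embedding maps the constants of M onto those of N, so its image is all of N.
module Submission where

open import Defs
open import Relation.Nullary using (¬_)
open import Data.Bool using (true; false; not)
open import Data.Bool.Properties using (¬-not; not-¬; not-involutive)
open import Data.Fin using (zero)
open import Data.Product using (Σ; _,_; proj₁; proj₂)
open import Function using (_∘_)
open import Relation.Binary.PropositionalEquality using (_≡_; _≢_; refl; sym; trans; cong; module ≡-Reasoning)
open ≡-Reasoning

module _ {τ : Vocabulary} {N : Structure τ} {v : Valuation N} (adm : Admissible N v) where
  open Admissible adm

  private
    ev : Term τ (Carrier N) 0 → Carrier N
    ev = evalT N (λ a → a) (noEnv N)

  v-≐-refl : ∀ t → v (t ≐ t) ≡ true
  v-≐-refl t = proj₂ (v-eq t t) refl

  v-≐-false : ∀ s t → ev s ≢ ev t → v (s ≐ t) ≡ false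
  v-≐-false s t s≢t = ¬-not (s≢t ∘ proj₁ (v-eq s t))

  v-¬-true⇒false : ∀ φ → v (¬' φ) ≡ true → v φ ≡ false
  v-¬-true⇒false φ ¬φ = begin
    v φ             ≡⟨ sym (not-involutive (v φ)) ⟩
    not (not (v φ)) ≡⟨ cong not (trans (sym (v-¬ φ)) ¬φ) ⟩
    false           ∎

  admissible⇒¬¬named : ∀ b → ¬ ¬ Named N b
  admissible⇒¬¬named b ¬named = not-¬ (v-≐-refl (par b)) (v-¬-true⇒false _ distinct-from-b)
    where
    φ : Formula τ (Carrier N) 1
    φ = ¬' (var zero ≐ par b)

    constants-distinct-from-b : ∀ c → v (φ [ con c ]) ≡ true
    constants-distinct-from-b c = begin
      v (¬' (con c ≐ par b))   ≡⟨ v-¬ _ ⟩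
      not (v (con c ≐ par b))  ≡⟨ cong not (v-≐-false (con c) (par b) (¬named ∘ (c ,_))) ⟩
      true                     ∎

    distinct-from-b : v (φ [ par b ]) ≡ true
    distinct-from-b = v-∀E φ (v-ω φ constants-distinct-from-b) (par b)

named⇒∈image : ∀ {τ} {M N : Structure τ} (e : Embedding M N) {b : Carrier N} →
               Named N b → Σ (Carrier M) λ a → Embedding.map e a ≡ b
named⇒∈image {M = M} e (c , c↦b) = const M c , trans (Embedding.pres-const e c) c↦b

theorem4p1p12 : (τ : Vocabulary) (T : Theory τ) → NamedSubmodelProperty T →
    (M N : Structure τ) → ModelΩ T M → ModelΩ T N →
    (e : Embedding M N) → ¬ Proper e
theorem4p1p12 τ T _ M N _ (v , adm , _) e (b , b∉image) =
  admissible⇒¬¬named adm b λ named →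
    let (a , a↦b) = named⇒∈image e named in b∉image a a↦b
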